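{- Let $\vec{a}=(a_1,a_2,\dots,a_n)$ be a non-decreasing sequence of positive integers, and let $$I_{\vec{a}}(q)=\sum_{(b_1,\dots,b_n)\in\mathcal{P}_{\vec{a}}} q^{b_1+b_2+\cdots+b_n-n}.$$ Then $$I_{\vec{a}}(-1)=\begin{cases}0, & \text{if } a_1 \text{ is even},\\ (-1)^{a_1+\cdots+a_n-n}\cdot \beta_n(S), & \text{if } a_1 \text{ is odd},\end{cases}$$ where $S=\{i\in[n-1] : a_{i+1}\text{ is odd}\}$.
   Context: For a non-decreasing sequence $\vec{a}=(a_1,\dots,a_n)$ of positive integers, a sequence $(b_1,\dots,b_n)$ of positive integers is an $\vec{a}$-parking function if its increasing rearrangement $b_1'\le b_2'\le\cdots\le b_n'$ satisfies $b_i'\le a_i$ for all $i$; $\mathcal{P}_{\vec{a}}$ denotes the set of all $\vec{a}$-parking functions. For $S\subseteq[n-1]$, $\beta_n(S)$ denotes the number of permutations $w_1w_2\cdots w_n$ of $[n]=\{1,\dots,n\}$ whose descent set $\{i\in[n-1]: w_i>w_{i+1}\}$ equals $S$. -}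

module Defs where

open import Data.Nat using (ℕ; zero; suc; _+_; _∸_; _≤_; _<_; _≤?_; _<?_; _%_; _⊔_)
open import Data.Nat.Properties using (≤-decTotalOrder; _≟_)
open import Data.Integer as ℤ using (ℤ; +_; -_)
open import Data.List using (List; []; _∷_; map; concatMap; filter; length; foldr; upTo)
open import Data.Nat.ListAction using (sum)
open import Data.List.Relation.Binary.Pointwise as PW using (Pointwise)
open import Data.List.Relation.Unary.All as All using (All)
open import Data.List.Relation.Unary.Unique.Propositional using (Unique)
open import Data.List.Relation.Unary.Unique.DecPropositional _≟_ using (unique?)
open import Data.List.Sort.InsertionSort ≤-decTotalOrder using (sort)
open import Data.Product using (_×_)
open import Relation.Nullary using (Dec; yes; no; does)
open import Data.Bool using (if_then_else_)
open import Relation.Nullary.Decidable using (_×-dec_)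
open import Relation.Binary.PropositionalEquality using (_≡_)
import Data.List.Properties as LP

words : ℕ → ℕ → List (List ℕ)
words zero    m = [] ∷ []
words (suc n) m = concatMap (λ x → map (x ∷_) (words n m)) (map suc (upTo m))

-- b is an a-parking function: entries are positive integers and the
-- increasing rearrangement of b is pointwise ≤ a (this also forces
-- length b ≡ length a).
IsParking : List ℕ → List ℕ → Set
IsParking a b = All (1 ≤_) b × Pointwise _≤_ (sort b) a

isParking? : ∀ a b → Dec (IsParking a b)
isParking? a b = All.all? (1 ≤?_) b ×-dec PW.decidable _≤?_ (sort b) a

-- The (finite) set P_a, listed without repetition: every a-parking
-- function has length n = length a and entries in {1,…,max a}
-- (since b'_i ≤ a_i ≤ max a), so it suffices to filter all such words.
maxList : List ℕ → ℕ
maxList = foldr _⊔_ 0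

parkingFunctions : List ℕ → List (List ℕ)
parkingFunctions a = filter (isParking? a) (words (length a) (maxList a))

I : List ℕ → ℤ → ℤ
I a q = sum′ (map (λ b → q ℤ.^ (sum b ∸ length a)) (parkingFunctions a))
  where
  sum′ : List ℤ → ℤ
  sum′ = foldr ℤ._+_ (+ 0)

permutations : ℕ → List (List ℕ)
permutations n = filter unique? (words n n)

-- Descent set of a word, as an increasing list of positions i ≥ k
-- (positions 1-based when k = 1) with w_i > w_{i+1}.
descentsFrom : ℕ → List ℕ → List ℕ
descentsFrom k []           = []
descentsFrom k (x ∷ [])     = []
descentsFrom k (x ∷ y ∷ ws) =
  if does (y <? x) then k ∷ descentsFrom (suc k) (y ∷ ws)
                   else descentsFrom (suc k) (y ∷ ws)

descentSet : List ℕ → List ℕ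
descentSet = descentsFrom 1

-- β_n(S), with S ⊆ [n-1] given as a strictly increasing list.
β : ℕ → List ℕ → ℕ
β n S = length (filter (λ w → LP.≡-dec _≟_ (descentSet w) S) (permutations n))

-- For a = (a_1, a_2, …, a_n): the set {i ∈ [n-1] : a_{i+1} odd},
-- as an increasing list. Given the tail (a_2,…,a_n) and the offset k
-- (starting at 1), list the indices i with a_{i+1} odd.
oddShiftedFrom : ℕ → List ℕ → List ℕ
oddShiftedFrom k []       = []
oddShiftedFrom k (x ∷ xs) with x % 2 ≟ 1
... | yes _ = k ∷ oddShiftedFrom (suc k) xs
... | no  _ = oddShiftedFrom (suc k) xs

module Submission where

-- Proof outline.  Write ε(x) for the parity of x and n for the length of a.
--
-- (1) Parking side.  Let J_m(a) = Σ_{w ∈ [m]^n} [w ∈ P_a]·(−1)^(Σw−n), so that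
--     I_a(−1) = J_{max a}(a).  Splitting off the first letter x of w: w is an
--     a-parking function iff its tail is parking for a∖x, the sorted list a with its
--     first entry ≥ x deleted (insert-delete⇒/⇐, parkingSign-cons).  Hence
--     J_m(a) = Σ_{x=1}^{m} (−1)^(x−1)·J_m(a∖x).  The x in an interval (a_{i−1}, a_i]
--     all delete a_i, and the alternating signs over that interval sum to
--     ε(a_i) − ε(a_{i−1}); so this sum is a "jump sum" Δsum of the parity word ε(a)
--     (alternatingDeletionSum).
-- (2) Permutation side.  Let B(r) be the number of permutations of [|r|+1] with descent
--     word r.  Inserting the maximum into the permutations of [|r|] at every position
--     yields a recursion for B (descentCount-rec), expressed through pullback and
--     changeSum.
-- (3) The function P(odd ∷ r) = σ(r)·B(r), P(even ∷ r) = 0 satisfies the jump-sum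
--     recursion (P-jump), so J_m(a) = P(ε(a)) by induction on n (J-parities).  The
--     theorem follows by identifying (−1)^(Σa−n) with σ and B with β_n.

open import Defs
open import Data.Nat using (ℕ; _≤_; _∸_; _%_)
open import Data.Integer as ℤ using (ℤ; +_; -_; _*_; _^_)
open import Data.List using (List; _∷_; length)
open import Data.Nat.ListAction using (sum)
open import Data.List.Relation.Unary.All using (All)
open import Data.List.Relation.Unary.Sorted.TotalOrder using (Sorted)
open import Data.Nat.Properties using (≤-totalOrder)
open import Data.Product using (_×_)
open import Relation.Binary.PropositionalEquality using (_≡_)

open import Data.Nat as ℕ using (zero; suc; _+_; _<_; z≤n; s≤s; _≤?_; _<?_)
import Data.Nat.Properties as ℕP
open import Data.Nat.Properties using (_≟_; ≤-decTotalOrder)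
open import Data.Nat.DivMod using ([m+n]%n≡m%n)
open import Data.Nat.ListAction.Properties using (sum-↭)
import Data.Nat.Tactic.RingSolver as ℕSolver
open import Data.Integer using () renaming (_+_ to _+ᵢ_; _-_ to _-ᵢ_; _*_ to _*ᵢ_)
import Data.Integer.Properties as ℤP
open import Data.Integer.Tactic.RingSolver using (solve-∀)
open import Data.Bool using (Bool; true; false; T; if_then_else_; not; _∧_; _xor_)
import Data.Bool.Properties as BoolP
open import Data.List
  using ([]; map; filter; concatMap; upTo; applyUpTo; _++_; foldr)
import Data.List.Properties as ListP
open import Data.List.Relation.Unary.All as All using ([]; _∷_)
import Data.List.Relation.Unary.All.Properties as AllP
open import Data.List.Relation.Unary.Any using (here; there)
open import Data.List.Relation.Unary.AllPairs as AllPairs using ([]; _∷_)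
open import Data.List.Relation.Unary.Linked.Properties using (Linked⇒AllPairs)
import Data.List.Relation.Unary.AllPairs.Properties as AllPairsP
open import Data.List.Relation.Unary.Linked as Linked using (Linked; [-]; _∷_)
open import Data.List.Relation.Unary.Unique.Propositional using (Unique)
import Data.List.Relation.Unary.Unique.Propositional.Properties as UniqueP
open import Data.List.Relation.Unary.Unique.DecPropositional _≟_ using (unique?)
open import Data.List.Relation.Binary.Pointwise using (Pointwise; []; _∷_; Pointwise-length)
open import Data.List.Relation.Binary.Disjoint.Propositional using (Disjoint)
open import Data.List.Relation.Binary.Permutation.Propositional using (_↭_)
import Data.List.Relation.Binary.Permutation.Propositional.Properties as PermP
open import Data.List.Relation.Binary.BagAndSetEquality using (∼bag⇒↭)
open import Data.List.Membership.Propositional using (_∈_; _∉_)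
open import Data.List.Membership.Propositional.Properties
open import Data.List.Membership.Propositional.Properties.WithK using (unique∧set⇒bag)
open import Data.List.Membership.DecPropositional _≟_ using (_∈?_)
open import Data.List.Sort.InsertionSort ≤-decTotalOrder using (sort)
open import Data.List.Sort.InsertionSort.Base ≤-decTotalOrder using (insert)
open import Data.List.Sort.InsertionSort.Properties ≤-decTotalOrder using (insert-↭; sort-↭)
open import Data.Maybe as Maybe using (Maybe; just; nothing)
open import Data.Product using (_,_; proj₂)
open import Data.Sum using (inj₁; inj₂)
open import Data.Empty using (⊥; ⊥-elim)
open import Function.Bundles using (mk⇔)
open import Relation.Nullary using (Dec; yes; no; does; ¬_)
open import Relation.Nullary.Decidable using (dec-true; dec-false)
open import Relation.Unary using (Pred; Decidable)
open import Level using (0ℓ)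
open import Relation.Binary.PropositionalEquality
  using (refl; sym; trans; cong; cong₂; subst; subst₂; _≢_; module ≡-Reasoning)
open ≡-Reasoning

⟦_⟧ : Bool → ℤ
⟦ true ⟧  = + 1
⟦ false ⟧ = + 0

χ : Bool → ℤ
χ true  = + 1
χ false = - + 1

isOdd : ℕ → Bool
isOdd zero    = false
isOdd (suc n) = not (isOdd n)

isOdd-% : ∀ x → x % 2 ≡ (if isOdd x then 1 else 0)
isOdd-% zero          = refl
isOdd-% (suc zero)    = refl
isOdd-% (suc (suc x)) = begin
  suc (suc x) % 2                       ≡⟨ cong (_% 2) (ℕP.+-comm 2 x) ⟩
  (x + 2) % 2                           ≡⟨ [m+n]%n≡m%n x 2 ⟩
  x % 2                                 ≡⟨ isOdd-% x ⟩
  (if isOdd x then 1 else 0)            ≡⟨ cong (λ b → if b then 1 else 0) (sym (BoolP.not-involutive (isOdd x))) ⟩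
  (if isOdd (suc (suc x)) then 1 else 0) ∎

%2≡0⇒even : ∀ x → x % 2 ≡ 0 → isOdd x ≡ false
%2≡0⇒even x h with isOdd x | isOdd-% x
... | false | _ = refl
... | true  | e with () ← trans (sym h) e

%2≡1⇒odd : ∀ x → x % 2 ≡ 1 → isOdd x ≡ true
%2≡1⇒odd x h with isOdd x | isOdd-% x
... | true  | _ = refl
... | false | e with () ← trans (sym h) e

-- (−1)^n, by a recursion under which negation is definitional.
sign : ℕ → ℤ
sign zero    = + 1
sign (suc n) = - sign n

sign-pow : ∀ n → (- + 1) ^ n ≡ sign n
sign-pow zero    = refl
sign-pow (suc n) = trans (ℤP.-1*i≡-i ((- + 1) ^ n)) (cong -_ (sign-pow n))

sign-+ : ∀ m n → sign (m + n) ≡ sign m *ᵢ sign n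
sign-+ zero    n = sym (ℤP.*-identityˡ (sign n))
sign-+ (suc m) n = trans (cong -_ (sign-+ m n)) (ℤP.neg-distribˡ-* (sign m) (sign n))

-- (−1)^n as a difference of parity indicators: this makes alternating sums telescope.
sign-parity : ∀ n → sign n ≡ ⟦ not (isOdd n) ⟧ -ᵢ ⟦ isOdd n ⟧
sign-parity zero = refl
sign-parity (suc n) with isOdd n | sign-parity n
... | true  | e = cong -_ e
... | false | e = cong -_ e

σ : List Bool → ℤ
σ []          = + 1
σ (true ∷ t)  = σ t
σ (false ∷ t) = - σ t

σ-cons : ∀ b t → σ (b ∷ t) ≡ χ b *ᵢ σ t
σ-cons true  t = sym (ℤP.*-identityˡ (σ t))
σ-cons false t = sym (ℤP.-1*i≡-i (σ t))

-- For x = n + 1: (−1)^(x−1) is the σ-contribution of the parity of x.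
sign-σ : ∀ n t → sign n *ᵢ σ t ≡ σ (isOdd (suc n) ∷ t)
sign-σ zero    t = ℤP.*-identityˡ (σ t)
sign-σ (suc n) t = begin
  - sign n *ᵢ σ t                   ≡⟨ sym (ℤP.neg-distribˡ-* (sign n) (σ t)) ⟩
  - (sign n *ᵢ σ t)                 ≡⟨ cong -_ (sign-σ n t) ⟩
  - σ (isOdd (suc n) ∷ t)           ≡⟨ flip (isOdd (suc n)) ⟩
  σ (not (isOdd (suc n)) ∷ t)       ∎
  where
  flip : ∀ b → - σ (b ∷ t) ≡ σ (not b ∷ t)
  flip true  = refl
  flip false = ℤP.neg-involutive (σ t)

length≤sum : ∀ w → All (1 ≤_) w → length w ≤ sum w
length≤sum []      []        = z≤n
length≤sum (x ∷ w) (p ∷ al) = ℕP.+-mono-≤ p (length≤sum w al)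

sign-sum : ∀ xs → All (1 ≤_) xs → sign (sum xs ∸ length xs) ≡ σ (map isOdd xs)
sign-sum []             []       = refl
sign-sum (suc x ∷ xs) (_ ∷ al) = begin
  sign (x + sum xs ∸ length xs)                ≡⟨ cong sign (ℕP.+-∸-assoc x (length≤sum xs al)) ⟩
  sign (x + (sum xs ∸ length xs))              ≡⟨ sign-+ x (sum xs ∸ length xs) ⟩
  sign x *ᵢ sign (sum xs ∸ length xs)          ≡⟨ cong (sign x *ᵢ_) (sign-sum xs al) ⟩
  sign x *ᵢ σ (map isOdd xs)                   ≡⟨ sign-σ x (map isOdd xs) ⟩
  σ (map isOdd (suc x ∷ xs))                   ∎

module BigSum {A : Set} (_∙_ : A → A → A) (ε : A)
              (identityˡ : ∀ x → ε ∙ x ≡ x)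
              (assoc : ∀ x y z → (x ∙ y) ∙ z ≡ x ∙ (y ∙ z)) where

  Σ : {B : Set} → (B → A) → List B → A
  Σ g L = foldr _∙_ ε (map g L)

  Σ< : ℕ → (ℕ → A) → A
  Σ< zero    h = ε
  Σ< (suc n) h = h 0 ∙ Σ< n (λ i → h (suc i))

  Σ-cong∈ : ∀ {B : Set} {g h : B → A} L → (∀ {x} → x ∈ L → g x ≡ h x) → Σ g L ≡ Σ h L
  Σ-cong∈ []      eq = refl
  Σ-cong∈ (x ∷ L) eq = cong₂ _∙_ (eq (here refl)) (Σ-cong∈ L (λ p → eq (there p)))

  Σ-cong : ∀ {B : Set} {g h : B → A} L → (∀ x → g x ≡ h x) → Σ g L ≡ Σ h L
  Σ-cong L eq = Σ-cong∈ L (λ {x} _ → eq x)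

  Σ<-cong : ∀ n {g h : ℕ → A} → (∀ i → g i ≡ h i) → Σ< n g ≡ Σ< n h
  Σ<-cong zero    eq = refl
  Σ<-cong (suc n) eq = cong₂ _∙_ (eq 0) (Σ<-cong n (λ i → eq (suc i)))

  Σ-ε : ∀ {B : Set} (L : List B) → Σ (λ _ → ε) L ≡ ε
  Σ-ε []      = refl
  Σ-ε (x ∷ L) = trans (identityˡ _) (Σ-ε L)

  Σ-map : ∀ {B C : Set} (g : C → A) (f : B → C) L → Σ g (map f L) ≡ Σ (λ x → g (f x)) L
  Σ-map g f L = cong (foldr _∙_ ε) (sym (ListP.map-∘ L))

  Σ-++ : ∀ {B : Set} (g : B → A) L M → Σ g (L ++ M) ≡ Σ g L ∙ Σ g M
  Σ-++ g []      M = sym (identityˡ _)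
  Σ-++ g (x ∷ L) M = trans (cong (g x ∙_) (Σ-++ g L M)) (sym (assoc (g x) _ _))

  Σ-concatMap : ∀ {B C : Set} (g : C → A) (f : B → List C) L →
                Σ g (concatMap f L) ≡ Σ (λ x → Σ g (f x)) L
  Σ-concatMap g f []      = refl
  Σ-concatMap g f (x ∷ L) = trans (Σ-++ g (f x) (concatMap f L)) (cong (Σ g (f x) ∙_) (Σ-concatMap g f L))

  Σ-filter : ∀ {B : Set} {P : Pred B 0ℓ} (P? : Decidable P) (g : B → A) L →
             Σ g (filter P? L) ≡ Σ (λ b → if does (P? b) then g b else ε) L
  Σ-filter P? g []      = refl
  Σ-filter P? g (x ∷ L) with does (P? x)
  ... | true  = cong (g x ∙_) (Σ-filter P? g L)
  ... | false = trans (Σ-filter P? g L) (sym (identityˡ _))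

  Σ-applyUpTo : ∀ (h : ℕ → A) f n → Σ h (applyUpTo f n) ≡ Σ< n (λ i → h (f i))
  Σ-applyUpTo h f zero    = refl
  Σ-applyUpTo h f (suc n) = cong (h (f 0) ∙_) (Σ-applyUpTo h (λ i → f (suc i)) n)

module Σℕ = BigSum _+_ 0 ℕP.+-identityˡ ℕP.+-assoc
module Σℤ = BigSum _+ᵢ_ (+ 0) ℤP.+-identityˡ ℤP.+-assoc

-- Jump sums over a parity word s, with s₀ = l as "previous" bit:
--   Δsum l s f     = Σ_j (⟦s_j⟧ − ⟦s_{j−1}⟧) · f(s with s_j deleted),
--   changeSum l s g = Σ_{j : s_j ≠ s_{j−1}} g(s with s_j deleted).
-- Δsum is the shape of the alternating parking sums; changeSum that of the
-- permutation recursion; Δsum-σ links the two.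
Δsum : Bool → List Bool → (List Bool → ℤ) → ℤ
Δsum l []      f = + 0
Δsum l (b ∷ s) f = (⟦ b ⟧ -ᵢ ⟦ l ⟧) *ᵢ f s +ᵢ Δsum b s (λ t → f (b ∷ t))

changeSum : Bool → List Bool → (List Bool → ℕ) → ℕ
changeSum l []      g = 0
changeSum l (b ∷ s) g = (if l xor b then g s else 0) + changeSum b s (λ t → g (b ∷ t))

Δsum-cong : ∀ l s {f g : List Bool → ℤ} → (∀ t → f t ≡ g t) → Δsum l s f ≡ Δsum l s g
Δsum-cong l []      eq = refl
Δsum-cong l (b ∷ s) eq =
  cong₂ _+ᵢ_ (cong ((⟦ b ⟧ -ᵢ ⟦ l ⟧) *ᵢ_) (eq s)) (Δsum-cong b s (λ t → eq (b ∷ t)))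

Δsum-scale : ∀ l s c (f : List Bool → ℤ) → Δsum l s (λ t → c *ᵢ f t) ≡ c *ᵢ Δsum l s f
Δsum-scale l []      c f = sym (ℤP.*-zeroʳ c)
Δsum-scale l (b ∷ s) c f = begin
  d *ᵢ (c *ᵢ f s) +ᵢ Δsum b s (λ t → c *ᵢ f (b ∷ t)) ≡⟨ cong (d *ᵢ (c *ᵢ f s) +ᵢ_) (Δsum-scale b s c _) ⟩
  d *ᵢ (c *ᵢ f s) +ᵢ c *ᵢ Δsum b s (λ t → f (b ∷ t)) ≡⟨ swap d c (f s) _ ⟩
  c *ᵢ (d *ᵢ f s +ᵢ Δsum b s (λ t → f (b ∷ t)))      ∎
  where
  d = ⟦ b ⟧ -ᵢ ⟦ l ⟧
  swap : ∀ d c x y → d *ᵢ (c *ᵢ x) +ᵢ c *ᵢ y ≡ c *ᵢ (d *ᵢ x +ᵢ y)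
  swap = solve-∀

jump-weight : ∀ l b y n → (⟦ b ⟧ -ᵢ ⟦ l ⟧) *ᵢ (y *ᵢ + n) ≡ χ b *ᵢ (y *ᵢ + (if l xor b then n else 0))
jump-weight true  true  y n = trans (ℤP.*-zeroˡ (y *ᵢ + n)) (sym (cong (+ 1 *ᵢ_) (ℤP.*-zeroʳ y)))
jump-weight true  false y n = refl
jump-weight false true  y n = refl
jump-weight false false y n = trans (ℤP.*-zeroˡ (y *ᵢ + n)) (sym (cong (- + 1 *ᵢ_) (ℤP.*-zeroʳ y)))

Δsum-σ : ∀ l s (g : List Bool → ℕ) → Δsum l s (λ t → σ t *ᵢ + g t) ≡ σ s *ᵢ + changeSum l s g
Δsum-σ l []      g = refl
Δsum-σ l (b ∷ s) g = begin
  (⟦ b ⟧ -ᵢ ⟦ l ⟧) *ᵢ (σ s *ᵢ + g s) +ᵢ Δsum b s (λ t → σ (b ∷ t) *ᵢ + g (b ∷ t))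
    ≡⟨ cong₂ _+ᵢ_ (jump-weight l b (σ s) (g s)) tail ⟩
  χ b *ᵢ (σ s *ᵢ + m) +ᵢ χ b *ᵢ (σ s *ᵢ + rest)
    ≡⟨ collect (χ b) (σ s) (+ m) (+ rest) ⟩
  (χ b *ᵢ σ s) *ᵢ (+ m +ᵢ + rest)
    ≡⟨ cong₂ _*ᵢ_ (sym (σ-cons b s)) (sym (ℤP.pos-+ m rest)) ⟩
  σ (b ∷ s) *ᵢ + (m + rest)
    ∎
  where
  m    = if l xor b then g s else 0
  rest = changeSum b s (λ t → g (b ∷ t))
  tail : Δsum b s (λ t → σ (b ∷ t) *ᵢ + g (b ∷ t)) ≡ χ b *ᵢ (σ s *ᵢ + rest)
  tail = begin
    Δsum b s (λ t → σ (b ∷ t) *ᵢ + g (b ∷ t))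
      ≡⟨ Δsum-cong b s (λ t → trans (cong (_*ᵢ + g (b ∷ t)) (σ-cons b t)) (ℤP.*-assoc (χ b) (σ t) _)) ⟩
    Δsum b s (λ t → χ b *ᵢ (σ t *ᵢ + g (b ∷ t)))
      ≡⟨ Δsum-scale b s (χ b) _ ⟩
    χ b *ᵢ Δsum b s (λ t → σ t *ᵢ + g (b ∷ t))
      ≡⟨ cong (χ b *ᵢ_) (Δsum-σ b s (λ t → g (b ∷ t))) ⟩
    χ b *ᵢ (σ s *ᵢ + rest)
      ∎
  collect : ∀ c y p q → c *ᵢ (y *ᵢ p) +ᵢ c *ᵢ (y *ᵢ q) ≡ (c *ᵢ y) *ᵢ (p +ᵢ q)
  collect = solve-∀

-- Inserting a new maximum at position k (0-based) into a permutation
-- with descent word t produces the descent word insMax k t: in front it creates a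
-- descent; between neighbours y z it replaces their bit by an ascent y<N and a
-- descent N>z; at the end it appends an ascent.
insMax : ℕ → List Bool → List Bool
insMax zero          t       = true ∷ t
insMax (suc k)       []      = false ∷ []
insMax (suc zero)    (c ∷ t) = false ∷ true ∷ t
insMax (suc (suc k)) (c ∷ t) = c ∷ insMax (suc k) t

-- pullback k r f = Σ { f t | insMax k t ≡ r }, computed by recursion on k and r.
pullback : ℕ → List Bool → (List Bool → ℕ) → ℕ
pullback zero          (true ∷ r)         f = f r
pullback zero          _                  f = 0
pullback (suc zero)    (false ∷ [])       f = f []
pullback (suc zero)    (false ∷ true ∷ s) f = f (false ∷ s) + f (true ∷ s)
pullback (suc zero)    _                  f = 0
pullback (suc (suc k)) []                 f = 0
pullback (suc (suc k)) (c ∷ [])           f = if c then 0 else f []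
pullback (suc (suc k)) (c ∷ d ∷ r)        f = pullback (suc k) (d ∷ r) (λ t → f (c ∷ t))

pullback-zero : ∀ k r (f : List Bool → ℕ) → (∀ t → f t ≡ 0) → pullback k r f ≡ 0
pullback-zero zero          []                  f z = refl
pullback-zero zero          (true ∷ r)          f z = z r
pullback-zero zero          (false ∷ r)         f z = refl
pullback-zero (suc zero)    []                  f z = refl
pullback-zero (suc zero)    (true ∷ r)          f z = refl
pullback-zero (suc zero)    (false ∷ [])        f z = z []
pullback-zero (suc zero)    (false ∷ false ∷ r) f z = refl
pullback-zero (suc zero)    (false ∷ true ∷ r)  f z = cong₂ _+_ (z _) (z _)
pullback-zero (suc (suc k)) []                  f z = refl
pullback-zero (suc (suc k)) (true ∷ [])         f z = refl
pullback-zero (suc (suc k)) (false ∷ [])        f z = z []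
pullback-zero (suc (suc k)) (c ∷ d ∷ r)         f z = pullback-zero (suc k) (d ∷ r) _ (λ t → z (c ∷ t))

pullback-cong : ∀ k r {f g : List Bool → ℕ} →
                (∀ t → suc (length t) ≡ length r → f t ≡ g t) → pullback k r f ≡ pullback k r g
pullback-cong zero          []                  eq = refl
pullback-cong zero          (true ∷ r)          eq = eq r refl
pullback-cong zero          (false ∷ r)         eq = refl
pullback-cong (suc zero)    []                  eq = refl
pullback-cong (suc zero)    (true ∷ r)          eq = refl
pullback-cong (suc zero)    (false ∷ [])        eq = eq [] refl
pullback-cong (suc zero)    (false ∷ false ∷ r) eq = refl
pullback-cong (suc zero)    (false ∷ true ∷ r)  eq = cong₂ _+_ (eq _ refl) (eq _ refl)
pullback-cong (suc (suc k)) []                  eq = refl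
pullback-cong (suc (suc k)) (true ∷ [])         eq = refl
pullback-cong (suc (suc k)) (false ∷ [])        eq = eq [] refl
pullback-cong (suc (suc k)) (c ∷ d ∷ r)         eq =
  pullback-cong (suc k) (d ∷ r) (λ t e → eq (c ∷ t) (cong suc e))

pullback-+ : ∀ k r (f g : List Bool → ℕ) →
             pullback k r (λ t → f t + g t) ≡ pullback k r f + pullback k r g
pullback-+ zero          []                  f g = refl
pullback-+ zero          (true ∷ r)          f g = refl
pullback-+ zero          (false ∷ r)         f g = refl
pullback-+ (suc zero)    []                  f g = refl
pullback-+ (suc zero)    (true ∷ r)          f g = refl
pullback-+ (suc zero)    (false ∷ [])        f g = refl
pullback-+ (suc zero)    (false ∷ false ∷ r) f g = refl
pullback-+ (suc zero)    (false ∷ true ∷ r)  f g = interchange (f _) (g _) (f _) (g _)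
  where
  interchange : ∀ a b c d → (a + b) + (c + d) ≡ (a + c) + (b + d)
  interchange = ℕSolver.solve-∀
pullback-+ (suc (suc k)) []                  f g = refl
pullback-+ (suc (suc k)) (true ∷ [])         f g = refl
pullback-+ (suc (suc k)) (false ∷ [])        f g = refl
pullback-+ (suc (suc k)) (c ∷ d ∷ r)         f g = pullback-+ (suc k) (d ∷ r) _ _

pullback-sum : ∀ {A : Set} k r (h : A → List Bool → ℕ) L →
  Σℕ.Σ (λ v → pullback k r (h v)) L ≡ pullback k r (λ t → Σℕ.Σ (λ v → h v t) L)
pullback-sum k r h []      = sym (pullback-zero k r _ (λ t → refl))
pullback-sum k r h (v ∷ L) = begin
  pullback k r (h v) + Σℕ.Σ (λ v → pullback k r (h v)) L
    ≡⟨ cong (_+_ (pullback k r (h v))) (pullback-sum k r h L) ⟩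
  pullback k r (h v) + pullback k r (λ t → Σℕ.Σ (λ v → h v t) L)
    ≡⟨ sym (pullback-+ k r (h v) _) ⟩
  pullback k r (λ t → h v t + Σℕ.Σ (λ v → h v t) L)
    ∎

-- Inserting the maximum anywhere but in front: a word r arises exactly at the
-- places where its bits change (reading a virtual leading `true`).
mutual
  pullback-inner : ∀ r (f : List Bool → ℕ) →
                   Σℕ.Σ< (length r) (λ i → pullback (suc i) r f) ≡ changeSum true r f
  pullback-inner []                f = refl
  pullback-inner (true ∷ [])       f = refl
  pullback-inner (true ∷ d ∷ s)    f = pullback-inner (d ∷ s) (λ t → f (true ∷ t))
  pullback-inner (false ∷ s)       f =
    trans (pullback-inner-false s f) (ℕP.+-comm (changeSum false s (λ t → f (false ∷ t))) (f s))

  pullback-inner-false : ∀ s (f : List Bool → ℕ) →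
    Σℕ.Σ< (suc (length s)) (λ i → pullback (suc i) (false ∷ s) f)
      ≡ changeSum false s (λ t → f (false ∷ t)) + f s
  pullback-inner-false []          f = ℕP.+-comm (f []) 0
  pullback-inner-false (false ∷ s) f = pullback-inner-false s (λ t → f (false ∷ t))
  pullback-inner-false (true ∷ s)  f = begin
    (f (false ∷ s) + f (true ∷ s)) + Σℕ.Σ< (length (true ∷ s)) (λ i → pullback (suc i) (true ∷ s) (λ t → f (false ∷ t)))
      ≡⟨ cong (_+_ (f (false ∷ s) + f (true ∷ s))) (pullback-inner (true ∷ s) (λ t → f (false ∷ t))) ⟩
    (f (false ∷ s) + f (true ∷ s)) + changeSum true s (λ t → f (false ∷ true ∷ t))
      ≡⟨ rearrange (f (false ∷ s)) (f (true ∷ s)) _ ⟩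
    (f (false ∷ s) + changeSum true s (λ t → f (false ∷ true ∷ t))) + f (true ∷ s)
      ∎
    where
    rearrange : ∀ x y z → x + y + z ≡ (x + z) + y
    rearrange = ℕSolver.solve-∀

sameBit : Bool → Bool → Bool
sameBit true  true  = true
sameBit false false = true
sameBit _     _     = false

sameWord : List Bool → List Bool → Bool
sameWord []      []      = true
sameWord (a ∷ s) (b ∷ t) = sameBit a b ∧ sameWord s t
sameWord _       _       = false

ind : Bool → ℕ
ind b = if b then 1 else 0

sameWord-sound : ∀ s t → sameWord s t ≡ true → s ≡ t
sameWord-sound []          []          _ = refl
sameWord-sound (true ∷ s)  (true ∷ t)  e = cong (true ∷_) (sameWord-sound s t e)
sameWord-sound (false ∷ s) (false ∷ t) e = cong (false ∷_) (sameWord-sound s t e)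

sameWord-refl : ∀ s → sameWord s s ≡ true
sameWord-refl []          = refl
sameWord-refl (true ∷ s)  = sameWord-refl s
sameWord-refl (false ∷ s) = sameWord-refl s

sameWord-insMax-[] : ∀ k s → sameWord (insMax k s) [] ≡ false
sameWord-insMax-[] zero          s       = refl
sameWord-insMax-[] (suc k)       []      = refl
sameWord-insMax-[] (suc zero)    (c ∷ s) = refl
sameWord-insMax-[] (suc (suc k)) (c ∷ s) = refl

∧-false : ∀ b → (b ∧ false) ≡ false
∧-false true  = refl
∧-false false = refl

pullback-indicator : ∀ k s r → ind (sameWord (insMax k s) r) ≡ pullback k r (λ t → ind (sameWord s t))
pullback-indicator zero          s           []                  = refl
pullback-indicator zero          s           (true ∷ r)          = refl
pullback-indicator zero          s           (false ∷ r)         = refl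
pullback-indicator (suc zero)    []          []                  = refl
pullback-indicator (suc zero)    []          (true ∷ r)          = refl
pullback-indicator (suc zero)    []          (false ∷ [])        = refl
pullback-indicator (suc zero)    []          (false ∷ false ∷ r) = refl
pullback-indicator (suc zero)    []          (false ∷ true ∷ r)  = refl
pullback-indicator (suc zero)    (c ∷ s)     []                  = refl
pullback-indicator (suc zero)    (c ∷ s)     (true ∷ r)          = refl
pullback-indicator (suc zero)    (c ∷ s)     (false ∷ [])        = refl
pullback-indicator (suc zero)    (c ∷ s)     (false ∷ false ∷ r) = refl
pullback-indicator (suc zero)    (false ∷ s) (false ∷ true ∷ r)  = sym (ℕP.+-identityʳ _)
pullback-indicator (suc zero)    (true ∷ s)  (false ∷ true ∷ r)  = refl
pullback-indicator (suc (suc k)) []          []                  = refl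
pullback-indicator (suc (suc k)) []          (true ∷ [])         = refl
pullback-indicator (suc (suc k)) []          (false ∷ [])        = refl
pullback-indicator (suc (suc k)) []          (c ∷ d ∷ r)         =
  trans (cong ind (∧-false (sameBit false c))) (sym (pullback-zero (suc k) (d ∷ r) _ (λ t → refl)))
pullback-indicator (suc (suc k)) (c ∷ s)     []                  = refl
pullback-indicator (suc (suc k)) (c ∷ s)     (true ∷ [])         =
  cong ind (trans (cong (sameBit c true ∧_) (sameWord-insMax-[] (suc k) s)) (∧-false _))
pullback-indicator (suc (suc k)) (c ∷ s)     (false ∷ [])        =
  cong ind (trans (cong (sameBit c false ∧_) (sameWord-insMax-[] (suc k) s)) (∧-false _))
pullback-indicator (suc (suc k)) (true ∷ s)  (true ∷ d ∷ r)      = pullback-indicator (suc k) s (d ∷ r)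
pullback-indicator (suc (suc k)) (false ∷ s) (false ∷ d ∷ r)     = pullback-indicator (suc k) s (d ∷ r)
pullback-indicator (suc (suc k)) (true ∷ s)  (false ∷ d ∷ r)     = sym (pullback-zero (suc k) (d ∷ r) _ (λ t → refl))
pullback-indicator (suc (suc k)) (false ∷ s) (true ∷ d ∷ r)      = sym (pullback-zero (suc k) (d ∷ r) _ (λ t → refl))

-- Interval sums Σ_{x = lo+1}^{lo+k} f x.
rangeSum : ℕ → ℕ → (ℕ → ℤ) → ℤ
rangeSum lo zero    f = + 0
rangeSum lo (suc k) f = f (suc lo) +ᵢ rangeSum (suc lo) k f

rangeSum-cong : ∀ lo k {f g : ℕ → ℤ} →
                (∀ x → lo < x → x ≤ lo + k → f x ≡ g x) → rangeSum lo k f ≡ rangeSum lo k g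
rangeSum-cong lo zero    eq = refl
rangeSum-cong lo (suc k) eq =
  cong₂ _+ᵢ_ (eq (suc lo) ℕP.≤-refl (s≤s (ℕP.m≤m+n lo k) ⟨≤≡⟩ sym (ℕP.+-suc lo k)))
             (rangeSum-cong (suc lo) k λ x lt le → eq x (ℕP.<-trans (ℕP.n<1+n lo) lt) (le ⟨≤≡⟩ sym (ℕP.+-suc lo k)))
  where
  _⟨≤≡⟩_ : ∀ {a b c} → a ≤ b → b ≡ c → a ≤ c
  le ⟨≤≡⟩ refl = le

rangeSum-split : ∀ lo k₁ k₂ f → rangeSum lo (k₁ + k₂) f ≡ rangeSum lo k₁ f +ᵢ rangeSum (lo + k₁) k₂ f
rangeSum-split lo zero     k₂ f =
  trans (cong (λ z → rangeSum z k₂ f) (sym (ℕP.+-identityʳ lo))) (sym (ℤP.+-identityˡ _))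
rangeSum-split lo (suc k₁) k₂ f = begin
  f (suc lo) +ᵢ rangeSum (suc lo) (k₁ + k₂) f
    ≡⟨ cong (f (suc lo) +ᵢ_) (rangeSum-split (suc lo) k₁ k₂ f) ⟩
  f (suc lo) +ᵢ (rangeSum (suc lo) k₁ f +ᵢ rangeSum (suc lo + k₁) k₂ f)
    ≡⟨ sym (ℤP.+-assoc (f (suc lo)) _ _) ⟩
  f (suc lo) +ᵢ rangeSum (suc lo) k₁ f +ᵢ rangeSum (suc lo + k₁) k₂ f
    ≡⟨ cong (λ z → f (suc lo) +ᵢ rangeSum (suc lo) k₁ f +ᵢ rangeSum z k₂ f) (sym (ℕP.+-suc lo k₁)) ⟩
  f (suc lo) +ᵢ rangeSum (suc lo) k₁ f +ᵢ rangeSum (lo + suc k₁) k₂ f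
    ∎

rangeSum-scale : ∀ lo k f c → rangeSum lo k (λ x → f x *ᵢ c) ≡ rangeSum lo k f *ᵢ c
rangeSum-scale lo zero    f c = sym (ℤP.*-zeroˡ c)
rangeSum-scale lo (suc k) f c =
  trans (cong (f (suc lo) *ᵢ c +ᵢ_) (rangeSum-scale (suc lo) k f c))
        (sym (ℤP.*-distribʳ-+ c (f (suc lo)) _))

rangeSum-zero : ∀ lo k → rangeSum lo k (λ _ → + 0) ≡ + 0
rangeSum-zero lo zero    = refl
rangeSum-zero lo (suc k) = trans (ℤP.+-identityˡ _) (rangeSum-zero (suc lo) k)

rangeSum-sign : ∀ lo k → rangeSum lo k (λ x → sign (x ∸ 1)) ≡ ⟦ isOdd (lo + k) ⟧ -ᵢ ⟦ isOdd lo ⟧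
rangeSum-sign lo zero    =
  trans (sym (ℤP.+-inverseʳ ⟦ isOdd lo ⟧)) (cong (λ z → ⟦ isOdd z ⟧ -ᵢ ⟦ isOdd lo ⟧) (sym (ℕP.+-identityʳ lo)))
rangeSum-sign lo (suc k) = begin
  sign lo +ᵢ rangeSum (suc lo) k (λ x → sign (x ∸ 1))
    ≡⟨ cong₂ _+ᵢ_ (sign-parity lo) (rangeSum-sign (suc lo) k) ⟩
  (⟦ not (isOdd lo) ⟧ -ᵢ ⟦ isOdd lo ⟧) +ᵢ (⟦ isOdd (suc lo + k) ⟧ -ᵢ ⟦ not (isOdd lo) ⟧)
    ≡⟨ telescope ⟦ not (isOdd lo) ⟧ ⟦ isOdd lo ⟧ ⟦ isOdd (suc lo + k) ⟧ ⟩
  ⟦ isOdd (suc lo + k) ⟧ -ᵢ ⟦ isOdd lo ⟧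
    ≡⟨ cong (λ z → ⟦ isOdd z ⟧ -ᵢ ⟦ isOdd lo ⟧) (sym (ℕP.+-suc lo k)) ⟩
  ⟦ isOdd (lo + suc k) ⟧ -ᵢ ⟦ isOdd lo ⟧
    ∎
  where
  telescope : ∀ a b c → (a -ᵢ b) +ᵢ (c -ᵢ a) ≡ c -ᵢ b
  telescope = solve-∀

delete≥ : ℕ → List ℕ → Maybe (List ℕ)
delete≥ x []      = nothing
delete≥ x (y ∷ a) with x ≤? y
... | yes _ = just a
... | no  _ = Maybe.map (y ∷_) (delete≥ x a)

delete≥-here : ∀ {x y} a → x ≤ y → delete≥ x (y ∷ a) ≡ just a
delete≥-here {x} {y} a x≤y with x ≤? y
... | yes _   = refl
... | no  x≰y = ⊥-elim (x≰y x≤y)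

delete≥-there : ∀ {x y} a → y < x → delete≥ x (y ∷ a) ≡ Maybe.map (y ∷_) (delete≥ x a)
delete≥-there {x} {y} a y<x with x ≤? y
... | yes x≤y = ⊥-elim (ℕP.<⇒≱ y<x x≤y)
... | no  _   = refl

atParities : (List Bool → ℤ) → Maybe (List ℕ) → ℤ
atParities f nothing  = + 0
atParities f (just a) = f (map isOdd a)

atParities-cons : ∀ f y d → atParities f (Maybe.map (y ∷_) d) ≡ atParities (λ t → f (isOdd y ∷ t)) d
atParities-cons f y nothing  = refl
atParities-cons f y (just a) = refl

sorted-head : ∀ {x xs} → Linked _≤_ (x ∷ xs) → All (x ≤_) xs
sorted-head lk = AllPairs.head (Linked⇒AllPairs ℕP.≤-trans lk)

-- Key summation: for sorted a with lo ≤ a ≤ lo + k, the alternating sum of f over the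
-- parity words of a∖x, x ∈ (lo, lo+k], is the jump sum of the parity word of a.
-- The x ∈ (lo, a₁] all delete a₁ and contribute (ε a₁ − ε lo)·f(ε a′) by
-- rangeSum-sign; the remaining x delete inside a′ and are handled by induction.
alternatingDeletionSum : ∀ a lo k f → Linked _≤_ a → All (lo ≤_) a → All (_≤ lo + k) a →
  rangeSum lo k (λ x → sign (x ∸ 1) *ᵢ atParities f (delete≥ x a)) ≡ Δsum (isOdd lo) (map isOdd a) f
alternatingDeletionSum [] lo k f _ _ _ =
  trans (rangeSum-cong lo k (λ x _ _ → ℤP.*-zeroʳ (sign (x ∸ 1)))) (rangeSum-zero lo k)
alternatingDeletionSum (a₁ ∷ a′) lo k f lk (lo≤a₁ ∷ _) (a₁≤ ∷ rest≤) = begin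
  rangeSum lo k F                                ≡⟨ cong (λ z → rangeSum lo z F) k≡k₁+k₂ ⟩
  rangeSum lo (k₁ + k₂) F                        ≡⟨ rangeSum-split lo k₁ k₂ F ⟩
  rangeSum lo k₁ F +ᵢ rangeSum (lo + k₁) k₂ F    ≡⟨ cong₂ _+ᵢ_ first rest ⟩
  (⟦ isOdd a₁ ⟧ -ᵢ ⟦ isOdd lo ⟧) *ᵢ f (map isOdd a′) +ᵢ Δsum (isOdd a₁) (map isOdd a′) (λ t → f (isOdd a₁ ∷ t))
    ∎
  where
  F  = λ x → sign (x ∸ 1) *ᵢ atParities f (delete≥ x (a₁ ∷ a′))
  k₁ = a₁ ∸ lo
  k₂ = k ∸ k₁
  lo+k₁≡a₁ : lo + k₁ ≡ a₁
  lo+k₁≡a₁ = ℕP.m+[n∸m]≡n lo≤a₁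
  k≡k₁+k₂ : k ≡ k₁ + k₂
  k≡k₁+k₂ = sym (ℕP.m+[n∸m]≡n (ℕP.+-cancelˡ-≤ lo k₁ k (subst (_≤ lo + k) (sym lo+k₁≡a₁) a₁≤)))
  lo+k≡a₁+k₂ : lo + k ≡ a₁ + k₂
  lo+k≡a₁+k₂ = trans (cong (_+_ lo) k≡k₁+k₂) (trans (sym (ℕP.+-assoc lo k₁ k₂)) (cong (_+ k₂) lo+k₁≡a₁))
  first : rangeSum lo k₁ F ≡ (⟦ isOdd a₁ ⟧ -ᵢ ⟦ isOdd lo ⟧) *ᵢ f (map isOdd a′)
  first = begin
    rangeSum lo k₁ F
      ≡⟨ rangeSum-cong lo k₁ (λ x _ le →
           cong (λ z → sign (x ∸ 1) *ᵢ atParities f z) (delete≥-here a′ (subst (x ≤_) lo+k₁≡a₁ le))) ⟩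
    rangeSum lo k₁ (λ x → sign (x ∸ 1) *ᵢ f (map isOdd a′))
      ≡⟨ rangeSum-scale lo k₁ (λ x → sign (x ∸ 1)) (f (map isOdd a′)) ⟩
    rangeSum lo k₁ (λ x → sign (x ∸ 1)) *ᵢ f (map isOdd a′)
      ≡⟨ cong (_*ᵢ f (map isOdd a′)) (rangeSum-sign lo k₁) ⟩
    (⟦ isOdd (lo + k₁) ⟧ -ᵢ ⟦ isOdd lo ⟧) *ᵢ f (map isOdd a′)
      ≡⟨ cong (λ z → (⟦ isOdd z ⟧ -ᵢ ⟦ isOdd lo ⟧) *ᵢ f (map isOdd a′)) lo+k₁≡a₁ ⟩
    (⟦ isOdd a₁ ⟧ -ᵢ ⟦ isOdd lo ⟧) *ᵢ f (map isOdd a′)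
      ∎
  rest : rangeSum (lo + k₁) k₂ F ≡ Δsum (isOdd a₁) (map isOdd a′) (λ t → f (isOdd a₁ ∷ t))
  rest = begin
    rangeSum (lo + k₁) k₂ F
      ≡⟨ cong (λ z → rangeSum z k₂ F) lo+k₁≡a₁ ⟩
    rangeSum a₁ k₂ F
      ≡⟨ rangeSum-cong a₁ k₂ (λ x a₁<x _ → cong (sign (x ∸ 1) *ᵢ_)
           (trans (cong (atParities f) (delete≥-there a′ a₁<x)) (atParities-cons f a₁ (delete≥ x a′)))) ⟩
    rangeSum a₁ k₂ (λ x → sign (x ∸ 1) *ᵢ atParities (λ t → f (isOdd a₁ ∷ t)) (delete≥ x a′))
      ≡⟨ alternatingDeletionSum a′ a₁ k₂ (λ t → f (isOdd a₁ ∷ t)) (Linked.tail lk) (sorted-head lk)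
           (All.map (λ {x} → subst (x ≤_) lo+k≡a₁+k₂) rest≤) ⟩
    Δsum (isOdd a₁) (map isOdd a′) (λ t → f (isOdd a₁ ∷ t))
      ∎

-- Parking functions.  Insertion sort compares with _≤ᵇ_; Compare reflects that test.
data Compare (x y : ℕ) : Bool → Set where
  is-≤ : x ≤ y → Compare x y true
  is-> : y < x → Compare x y false

compare : ∀ x y → Compare x y (x ℕ.≤ᵇ y)
compare x y with x ℕ.≤ᵇ y in eq
... | true  = is-≤ (ℕP.≤ᵇ⇒≤ x y (subst T (sym eq) _))
... | false = is-> (ℕP.≰⇒> (λ x≤y → subst T eq (ℕP.≤⇒≤ᵇ x≤y)))

insert-length : ∀ x c → length (insert x c) ≡ suc (length c)
insert-length x c = PermP.↭-length (insert-↭ x c)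

BoundedBy : List ℕ → Maybe (List ℕ) → Set
BoundedBy c nothing  = ⊥
BoundedBy c (just a) = Pointwise _≤_ c a

¬insert≤[] : ∀ x c → ¬ Pointwise _≤_ (insert x c) []
¬insert≤[] x c p with () ← trans (sym (insert-length x c)) (Pointwise-length p)

insert-delete⇒ : ∀ x c a → Linked _≤_ a → Pointwise _≤_ (insert x c) a → BoundedBy c (delete≥ x a)
insert-delete⇒ x [] (a₁ ∷ []) _ (x≤a₁ ∷ []) rewrite delete≥-here [] x≤a₁ = []
insert-delete⇒ x (y ∷ c) a lk c≤a with x ℕ.≤ᵇ y | compare x y
insert-delete⇒ x (y ∷ c) (a₁ ∷ a′) lk (x≤a₁ ∷ c≤a′) | .true | is-≤ _ rewrite delete≥-here a′ x≤a₁ = c≤a′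
insert-delete⇒ x (y ∷ c) (a₁ ∷ a′) lk (y≤a₁ ∷ xc≤a′) | .false | is-> y<x with ℕP.≤-<-connex x a₁
... | inj₁ x≤a₁ rewrite delete≥-here a′ x≤a₁ = shift a′ lk xc≤a′ (insert-delete⇒ x c a′ (Linked.tail lk) xc≤a′)
  where
  shift : ∀ a′ → Linked _≤_ (a₁ ∷ a′) → Pointwise _≤_ (insert x c) a′ → BoundedBy c (delete≥ x a′) →
          Pointwise _≤_ (y ∷ c) a′
  shift []         _          xc≤[] _ = ⊥-elim (¬insert≤[] x c xc≤[])
  shift (a₂ ∷ a″) (a₁≤a₂ ∷ _) _     c≤ rewrite delete≥-here a″ (ℕP.≤-trans x≤a₁ a₁≤a₂) =
    ℕP.≤-trans y≤a₁ a₁≤a₂ ∷ c≤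
... | inj₂ a₁<x rewrite delete≥-there a′ a₁<x = keep (delete≥ x a′) (insert-delete⇒ x c a′ (Linked.tail lk) xc≤a′)
  where
  keep : ∀ d → BoundedBy c d → BoundedBy (y ∷ c) (Maybe.map (a₁ ∷_) d)
  keep (just d) c≤d = y≤a₁ ∷ c≤d

insert-delete⇐ : ∀ x c a → Linked _≤_ a → BoundedBy c (delete≥ x a) → Pointwise _≤_ (insert x c) a
insert-delete⇐ x [] (a₁ ∷ a′) lk h with ℕP.≤-<-connex x a₁
... | inj₁ x≤a₁ = single a′ h
  where
  single : ∀ a′ → BoundedBy [] (delete≥ x (a₁ ∷ a′)) → Pointwise _≤_ (x ∷ []) (a₁ ∷ a′)
  single a′ h rewrite delete≥-here a′ x≤a₁ with a′ | h
  ... | [] | [] = x≤a₁ ∷ []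
... | inj₂ a₁<x = ⊥-elim (nonempty (delete≥ x a′) (subst (BoundedBy []) (delete≥-there a′ a₁<x) h))
  where
  nonempty : ∀ d → ¬ BoundedBy [] (Maybe.map (a₁ ∷_) d)
  nonempty (just d) ()
insert-delete⇐ x (y ∷ c) a lk h with x ℕ.≤ᵇ y | compare x y
insert-delete⇐ x (y ∷ c) (a₁ ∷ a′) lk h | .true | is-≤ x≤y with ℕP.≤-<-connex x a₁
... | inj₁ x≤a₁ = x≤a₁ ∷ subst (BoundedBy (y ∷ c)) (delete≥-here a′ x≤a₁) h
... | inj₂ a₁<x = ⊥-elim (too-small (delete≥ x a′) (subst (BoundedBy (y ∷ c)) (delete≥-there a′ a₁<x) h))
  where
  too-small : ∀ d → ¬ BoundedBy (y ∷ c) (Maybe.map (a₁ ∷_) d)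
  too-small (just d) (y≤a₁ ∷ _) = ℕP.<⇒≱ a₁<x (ℕP.≤-trans x≤y y≤a₁)
insert-delete⇐ x (y ∷ c) (a₁ ∷ a′) lk h | .false | is-> y<x with ℕP.≤-<-connex x a₁
... | inj₁ x≤a₁ = unshift a′ lk (subst (BoundedBy (y ∷ c)) (delete≥-here a′ x≤a₁) h)
  where
  unshift : ∀ a′ → Linked _≤_ (a₁ ∷ a′) → Pointwise _≤_ (y ∷ c) a′ → Pointwise _≤_ (y ∷ insert x c) (a₁ ∷ a′)
  unshift (a₂ ∷ a″) lk′ (_ ∷ c≤a″) = ℕP.≤-trans (ℕP.<⇒≤ y<x) x≤a₁
    ∷ insert-delete⇐ x c (a₂ ∷ a″) (Linked.tail lk′)
        (subst (BoundedBy c) (sym (delete≥-here a″ (ℕP.≤-trans x≤a₁ (Linked.head lk′)))) c≤a″)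
... | inj₂ a₁<x = keep (delete≥ x a′) refl (subst (BoundedBy (y ∷ c)) (delete≥-there a′ a₁<x) h)
  where
  keep : ∀ d → delete≥ x a′ ≡ d → BoundedBy (y ∷ c) (Maybe.map (a₁ ∷_) d) → Pointwise _≤_ (y ∷ insert x c) (a₁ ∷ a′)
  keep (just d) eq (y≤a₁ ∷ c≤d) = y≤a₁ ∷ insert-delete⇐ x c a′ (Linked.tail lk) (subst (BoundedBy c) (sym eq) c≤d)

delete≥-length : ∀ x a a′ → delete≥ x a ≡ just a′ → length a ≡ suc (length a′)
delete≥-length x [] a′ ()
delete≥-length x (y ∷ a) a′ eq with ℕP.≤-<-connex x y
... | inj₁ x≤y rewrite delete≥-here a x≤y with eq
...   | refl = refl
delete≥-length x (y ∷ a) a′ eq | inj₂ y<x rewrite delete≥-there a y<x with delete≥ x a in e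
...   | just d with eq
...     | refl = cong suc (delete≥-length x a d e)

delete≥-all : ∀ {P : ℕ → Set} x a a′ → delete≥ x a ≡ just a′ → All P a → All P a′
delete≥-all x [] a′ () al
delete≥-all x (y ∷ a) a′ eq (py ∷ al) with ℕP.≤-<-connex x y
... | inj₁ x≤y rewrite delete≥-here a x≤y with eq
...   | refl = al
delete≥-all x (y ∷ a) a′ eq (py ∷ al) | inj₂ y<x rewrite delete≥-there a y<x with delete≥ x a in e
...   | just d with eq
...     | refl = py ∷ delete≥-all x a d e al

sorted-cons : ∀ {y d} → All (y ≤_) d → Linked _≤_ d → Linked _≤_ (y ∷ d)
sorted-cons {d = []}    _       _  = [-]
sorted-cons {d = z ∷ d} (y≤z ∷ _) lk = y≤z ∷ lk

delete≥-sorted : ∀ x a a′ → delete≥ x a ≡ just a′ → Linked _≤_ a → Linked _≤_ a′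
delete≥-sorted x [] a′ () lk
delete≥-sorted x (y ∷ a) a′ eq lk with ℕP.≤-<-connex x y
... | inj₁ x≤y rewrite delete≥-here a x≤y with eq
...   | refl = Linked.tail lk
delete≥-sorted x (y ∷ a) a′ eq lk | inj₂ y<x rewrite delete≥-there a y<x with delete≥ x a in e
...   | just d with eq
...     | refl = sorted-cons (delete≥-all x a d e (sorted-head lk)) (delete≥-sorted x a d e (Linked.tail lk))

parkingSign : List ℕ → List ℕ → ℤ
parkingSign a b = if does (isParking? a b) then (- + 1) ^ (sum b ∸ length a) else + 0

parkingSignᴹ : Maybe (List ℕ) → List ℕ → ℤ
parkingSignᴹ nothing   w = + 0
parkingSignᴹ (just a′) w = parkingSign a′ w

parkingSign-yes : ∀ a b → IsParking a b → parkingSign a b ≡ (- + 1) ^ (sum b ∸ length a)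
parkingSign-yes a b p = cong (λ z → if z then (- + 1) ^ (sum b ∸ length a) else + 0) (dec-true (isParking? a b) p)

parkingSign-no : ∀ a b → ¬ IsParking a b → parkingSign a b ≡ + 0
parkingSign-no a b p = cong (λ z → if z then (- + 1) ^ (sum b ∸ length a) else + 0) (dec-false (isParking? a b) p)

parkingSign-cons : ∀ x w a → 1 ≤ x → Linked _≤_ a →
                   parkingSign a (x ∷ w) ≡ sign (x ∸ 1) *ᵢ parkingSignᴹ (delete≥ x a) w
parkingSign-cons (suc x) w a _ lk with isParking? a (suc x ∷ w)
... | yes park@(_ ∷ w-pos , xw≤a) =
  trans (parkingSign-yes a (suc x ∷ w) park)
        (parked (delete≥ (suc x) a) refl (insert-delete⇒ (suc x) (sort w) a lk xw≤a))
  where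
  parked : ∀ d → delete≥ (suc x) a ≡ d → BoundedBy (sort w) d →
           (- + 1) ^ (sum (suc x ∷ w) ∸ length a) ≡ sign x *ᵢ parkingSignᴹ d w
  parked (just a′) eq w≤a′ = begin
    (- + 1) ^ (suc x + sum w ∸ length a)        ≡⟨ sign-pow (suc x + sum w ∸ length a) ⟩
    sign (suc x + sum w ∸ length a)
      ≡⟨ cong (λ n → sign (suc x + sum w ∸ n)) (delete≥-length (suc x) a a′ eq) ⟩
    sign (x + sum w ∸ length a′)                ≡⟨ cong sign (ℕP.+-∸-assoc x |a′|≤Σw) ⟩
    sign (x + (sum w ∸ length a′))              ≡⟨ sign-+ x _ ⟩
    sign x *ᵢ sign (sum w ∸ length a′)          ≡⟨ cong (sign x *ᵢ_) (sym (sign-pow (sum w ∸ length a′))) ⟩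
    sign x *ᵢ (- + 1) ^ (sum w ∸ length a′)     ≡⟨ cong (sign x *ᵢ_) (sym (parkingSign-yes a′ w (w-pos , w≤a′))) ⟩
    sign x *ᵢ parkingSign a′ w                  ∎
    where
    |a′|≤Σw : length a′ ≤ sum w
    |a′|≤Σw = subst (_≤ sum w) (trans (sym (PermP.↭-length (sort-↭ w))) (Pointwise-length w≤a′)) (length≤sum w w-pos)
... | no ¬park = trans (parkingSign-no a (suc x ∷ w) ¬park) (unparked (delete≥ (suc x) a) refl)
  where
  unparked : ∀ d → delete≥ (suc x) a ≡ d → + 0 ≡ sign x *ᵢ parkingSignᴹ d w
  unparked nothing   _ = sym (ℤP.*-zeroʳ (sign x))
  unparked (just a′) eq with isParking? a′ w
  ... | no ¬park′ = trans (sym (ℤP.*-zeroʳ (sign x))) (cong (sign x *ᵢ_) (sym (parkingSign-no a′ w ¬park′)))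
  ... | yes (w-pos , w≤a′) =
    ⊥-elim (¬park (s≤s z≤n ∷ w-pos , insert-delete⇐ (suc x) (sort w) a lk (subst (BoundedBy (sort w)) (sym eq) w≤a′)))

Σℤ-scale : ∀ {B : Set} c (g : B → ℤ) L → Σℤ.Σ (λ x → c *ᵢ g x) L ≡ c *ᵢ Σℤ.Σ g L
Σℤ-scale c g []      = sym (ℤP.*-zeroʳ c)
Σℤ-scale c g (x ∷ L) = trans (cong (c *ᵢ g x +ᵢ_) (Σℤ-scale c g L)) (sym (ℤP.*-distribˡ-+ c (g x) _))

Σ<-rangeSum : ∀ m lo h → Σℤ.Σ< m (λ i → h (suc (lo + i))) ≡ rangeSum lo m h
Σ<-rangeSum zero    lo h = refl
Σ<-rangeSum (suc m) lo h = cong₂ _+ᵢ_ (cong (λ z → h (suc z)) (ℕP.+-identityʳ lo)) (begin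
  Σℤ.Σ< m (λ i → h (suc (lo + suc i)))   ≡⟨ Σℤ.Σ<-cong m (λ i → cong (λ z → h (suc z)) (ℕP.+-suc lo i)) ⟩
  Σℤ.Σ< m (λ i → h (suc (suc lo + i)))   ≡⟨ Σ<-rangeSum m (suc lo) h ⟩
  rangeSum (suc lo) m h                  ∎)

J : ℕ → List ℕ → ℤ
J m a = Σℤ.Σ (parkingSign a) (words (length a) m)

Jᴹ : ℕ → Maybe (List ℕ) → ℤ
Jᴹ m nothing   = + 0
Jᴹ m (just a′) = J m a′

I-as-J : ∀ a → I a (- + 1) ≡ J (maxList a) a
I-as-J a = Σℤ.Σ-filter (isParking? a) (λ b → (- + 1) ^ (sum b ∸ length a)) (words (length a) (maxList a))

J-first-letter : ∀ m a₁ a′ → Linked _≤_ (a₁ ∷ a′) →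
  J m (a₁ ∷ a′) ≡ rangeSum 0 m (λ x → sign (x ∸ 1) *ᵢ Jᴹ m (delete≥ x (a₁ ∷ a′)))
J-first-letter m a₁ a′ lk = begin
  Σℤ.Σ (parkingSign a) (concatMap (λ x → map (x ∷_) ws) (map suc (upTo m)))
    ≡⟨ Σℤ.Σ-concatMap (parkingSign a) (λ x → map (x ∷_) ws) (map suc (upTo m)) ⟩
  Σℤ.Σ starting-with (map suc (upTo m))
    ≡⟨ Σℤ.Σ-map starting-with suc (upTo m) ⟩
  Σℤ.Σ (λ i → starting-with (suc i)) (upTo m)
    ≡⟨ Σℤ.Σ-applyUpTo (λ i → starting-with (suc i)) (λ i → i) m ⟩
  Σℤ.Σ< m (λ i → starting-with (suc i))
    ≡⟨ Σ<-rangeSum m 0 starting-with ⟩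
  rangeSum 0 m starting-with
    ≡⟨ rangeSum-cong 0 m (λ x 0<x _ → starting-with-x x 0<x) ⟩
  rangeSum 0 m (λ x → sign (x ∸ 1) *ᵢ Jᴹ m (delete≥ x a))
    ∎
  where
  a  = a₁ ∷ a′
  ws = words (length a′) m
  starting-with : ℕ → ℤ
  starting-with x = Σℤ.Σ (parkingSign a) (map (x ∷_) ws)
  remaining : ∀ x d → delete≥ x a ≡ d → Σℤ.Σ (parkingSignᴹ d) ws ≡ Jᴹ m d
  remaining x nothing   _  = Σℤ.Σ-ε ws
  remaining x (just a″) eq = cong (λ n → Σℤ.Σ (parkingSign a″) (words n m)) (ℕP.suc-injective (delete≥-length x a a″ eq))
  starting-with-x : ∀ x → 0 < x → starting-with x ≡ sign (x ∸ 1) *ᵢ Jᴹ m (delete≥ x a)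
  starting-with-x x 0<x = begin
    starting-with x                                         ≡⟨ Σℤ.Σ-map (parkingSign a) (x ∷_) ws ⟩
    Σℤ.Σ (λ w → parkingSign a (x ∷ w)) ws                   ≡⟨ Σℤ.Σ-cong ws (λ w → parkingSign-cons x w a 0<x lk) ⟩
    Σℤ.Σ (λ w → sign (x ∸ 1) *ᵢ parkingSignᴹ (delete≥ x a) w) ws ≡⟨ Σℤ-scale (sign (x ∸ 1)) _ ws ⟩
    sign (x ∸ 1) *ᵢ Σℤ.Σ (parkingSignᴹ (delete≥ x a)) ws    ≡⟨ cong (sign (x ∸ 1) *ᵢ_) (remaining x (delete≥ x a) refl) ⟩
    sign (x ∸ 1) *ᵢ Jᴹ m (delete≥ x a)                      ∎

Δsum-zero : ∀ l s → Δsum l s (λ _ → + 0) ≡ + 0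
Δsum-zero l []      = refl
Δsum-zero l (b ∷ s) = cong₂ _+ᵢ_ (ℤP.*-zeroʳ (⟦ b ⟧ -ᵢ ⟦ l ⟧)) (Δsum-zero b s)

-- Given a count B on parity words with B [] = 1 and the recursion that inserting a
-- maximum produces, the signed parking count of a sorted list a is P(ε(a)).
module ParityEvaluation (B : List Bool → ℕ) (B-[] : B [] ≡ 1)
    (B-rec : ∀ d r → B (d ∷ r) ≡ pullback 0 (d ∷ r) B + changeSum true (d ∷ r) B) where

  P : List Bool → ℤ
  P []          = + 1
  P (false ∷ _) = + 0
  P (true ∷ r)  = σ r *ᵢ + B r

  P-front : ∀ d r → P (d ∷ r) ≡ σ (d ∷ r) *ᵢ + pullback 0 (d ∷ r) B
  P-front true  r = refl
  P-front false r = sym (ℤP.*-zeroʳ (- σ r))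

  -- P satisfies the jump-sum recursion of alternatingDeletionSum (with ε(0) = even).
  P-jump : ∀ b r → P (b ∷ r) ≡ Δsum false (b ∷ r) P
  P-jump false r       = sym (trans (ℤP.+-identityˡ _) (Δsum-zero false r))
  P-jump true  []      = cong (λ n → + 1 *ᵢ + n) B-[]
  P-jump true  (d ∷ r) = sym (begin
    + 1 *ᵢ P (d ∷ r) +ᵢ Δsum true (d ∷ r) (λ t → σ t *ᵢ + B t)
      ≡⟨ cong₂ _+ᵢ_ (trans (ℤP.*-identityˡ _) (P-front d r)) (Δsum-σ true (d ∷ r) B) ⟩
    σ (d ∷ r) *ᵢ + pullback 0 (d ∷ r) B +ᵢ σ (d ∷ r) *ᵢ + changeSum true (d ∷ r) B
      ≡⟨ sym (ℤP.*-distribˡ-+ (σ (d ∷ r)) _ _) ⟩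
    σ (d ∷ r) *ᵢ (+ pullback 0 (d ∷ r) B +ᵢ + changeSum true (d ∷ r) B)
      ≡⟨ cong (σ (d ∷ r) *ᵢ_) (sym (ℤP.pos-+ (pullback 0 (d ∷ r) B) (changeSum true (d ∷ r) B))) ⟩
    σ (d ∷ r) *ᵢ + (pullback 0 (d ∷ r) B + changeSum true (d ∷ r) B)
      ≡⟨ cong (λ n → σ (d ∷ r) *ᵢ + n) (sym (B-rec d r)) ⟩
    σ (d ∷ r) *ᵢ + B (d ∷ r)
      ∎)

  J-parities : ∀ n m a → length a ≡ n → Linked _≤_ a → All (_≤ m) a → J m a ≡ P (map isOdd a)
  J-parities zero    m []         _   _  _   = refl
  J-parities (suc n) m (a₁ ∷ a′) len lk a≤m = begin
    J m a
      ≡⟨ J-first-letter m a₁ a′ lk ⟩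
    rangeSum 0 m (λ x → sign (x ∸ 1) *ᵢ Jᴹ m (delete≥ x a))
      ≡⟨ rangeSum-cong 0 m (λ x _ _ → cong (sign (x ∸ 1) *ᵢ_) (induction x (delete≥ x a) refl)) ⟩
    rangeSum 0 m (λ x → sign (x ∸ 1) *ᵢ atParities P (delete≥ x a))
      ≡⟨ alternatingDeletionSum a 0 m P lk (All.universal (λ _ → z≤n) a) a≤m ⟩
    Δsum false (map isOdd a) P
      ≡⟨ sym (P-jump (isOdd a₁) (map isOdd a′)) ⟩
    P (map isOdd a)
      ∎
    where
    a = a₁ ∷ a′
    induction : ∀ x d → delete≥ x a ≡ d → Jᴹ m d ≡ atParities P d
    induction x nothing   _  = refl
    induction x (just a″) eq = J-parities n m a″ (ℕP.suc-injective (trans (sym (delete≥-length x a a″ eq)) len))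
                                 (delete≥-sorted x a a″ eq lk) (delete≥-all x a a″ eq a≤m)

InRange : ℕ → ℕ → Set
InRange m x = 1 ≤ x × x ≤ m

∈-range⁻ : ∀ {m x} → x ∈ map suc (upTo m) → InRange m x
∈-range⁻ {m} p with ∈-map⁻ suc p
... | i , i∈ , refl = s≤s z≤n , ∈-upTo⁻ i∈

∈-range⁺ : ∀ {m x} → InRange m x → x ∈ map suc (upTo m)
∈-range⁺ {m} {suc x} (_ , le) = ∈-map⁺ suc (∈-upTo⁺ le)

∈-words⁻ : ∀ n m w → w ∈ words n m → length w ≡ n × All (InRange m) w
∈-words⁻ zero m [] (here refl) = refl , []
∈-words⁻ (suc n) m w p with ∈-concat⁻′ (map (λ x → map (x ∷_) (words n m)) (map suc (upTo m))) p
... | vs , w∈vs , vs∈ with ∈-map⁻ (λ x → map (x ∷_) (words n m)) vs∈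
... | x , x∈ , refl with ∈-map⁻ (x ∷_) w∈vs
... | w' , w'∈ , refl with ∈-words⁻ n m w' w'∈
... | len , al = cong suc len , ∈-range⁻ x∈ ∷ al

∈-words⁺ : ∀ n m w → length w ≡ n → All (InRange m) w → w ∈ words n m
∈-words⁺ zero m [] refl [] = here refl
∈-words⁺ (suc n) m (x ∷ w) len (px ∷ al) =
  ∈-concat⁺′ (∈-map⁺ (x ∷_) (∈-words⁺ n m w (ℕP.suc-injective len) al))
             (∈-map⁺ (λ x → map (x ∷_) (words n m)) (∈-range⁺ px))

-- The enumerations are duplicate-free, so sums over them are sums over sets.
words-unique : ∀ n m → Unique (words n m)
words-unique zero m = [] ∷ []
words-unique (suc n) m =
  UniqueP.concat⁺
    (AllP.map⁺ (All.universal (λ x → UniqueP.map⁺ {f = x ∷_} ListP.∷-injectiveʳ (words-unique n m)) (map suc (upTo m))))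
    (AllPairsP.map⁺ (AllPairs.map disj (UniqueP.map⁺ ℕP.suc-injective (UniqueP.upTo⁺ m))))
  where
  disj : ∀ {x y} → x ≢ y → Disjoint (map (x ∷_) (words n m)) (map (y ∷_) (words n m))
  disj x≢y (p , q) with ∈-map⁻ _ p | ∈-map⁻ _ q
  ... | _ , _ , refl | _ , _ , refl = x≢y refl

∈-permutations⁻ : ∀ n w → w ∈ permutations n → length w ≡ n × All (InRange n) w × Unique w
∈-permutations⁻ n w p with ∈-filter⁻ unique? {xs = words n n} p
... | w∈ , u with ∈-words⁻ n n w w∈
... | len , al = len , al , u

∈-permutations⁺ : ∀ n w → length w ≡ n → All (InRange n) w → Unique w → w ∈ permutations n
∈-permutations⁺ n w len al u = ∈-filter⁺ unique? (∈-words⁺ n n w len al) u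

permutations-unique : ∀ n → Unique (permutations n)
permutations-unique n = UniqueP.filter⁺ unique? (words-unique n n)

insertAt : ℕ → ℕ → List ℕ → List ℕ
insertAt zero x v = x ∷ v
insertAt (suc k) x [] = x ∷ []
insertAt (suc k) x (y ∷ v) = y ∷ insertAt k x v

position : ℕ → List ℕ → ℕ
position x [] = 0
position x (y ∷ w) with y ≟ x
... | yes _ = 0
... | no _ = suc (position x w)

remove : ℕ → List ℕ → List ℕ
remove x [] = []
remove x (y ∷ w) with y ≟ x
... | yes _ = w
... | no _ = y ∷ remove x w

insertAt-position-remove : ∀ x w → x ∈ w → insertAt (position x w) x (remove x w) ≡ w
insertAt-position-remove x (y ∷ w) p with y ≟ x
... | yes refl = refl
... | no y≢x with p
...   | here eq = ⊥-elim (y≢x (sym eq))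
...   | there p' = cong (y ∷_) (insertAt-position-remove x w p')

position< : ∀ x w → x ∈ w → position x w < length w
position< x (y ∷ w) p with y ≟ x
... | yes _ = s≤s z≤n
... | no y≢x with p
...   | here eq = ⊥-elim (y≢x (sym eq))
...   | there p' = s≤s (position< x w p')

remove-length : ∀ x w → x ∈ w → suc (length (remove x w)) ≡ length w
remove-length x (y ∷ w) p with y ≟ x
... | yes _ = refl
... | no y≢x with p
...   | here eq = ⊥-elim (y≢x (sym eq))
...   | there p' = cong suc (remove-length x w p')

remove-⊆ : ∀ x w {z} → z ∈ remove x w → z ∈ w
remove-⊆ x (y ∷ w) p with y ≟ x
... | yes _ = there p
... | no _ with p
...   | here eq = here eq
...   | there p' = there (remove-⊆ x w p')

remove-⊇ : ∀ x w {z} → z ∈ w → z ≢ x → z ∈ remove x w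
remove-⊇ x (y ∷ w) p z≢x with y ≟ x
remove-⊇ x (y ∷ w) (here refl) z≢x | yes y≡x = ⊥-elim (z≢x y≡x)
remove-⊇ x (y ∷ w) (there p) z≢x | yes y≡x = p
remove-⊇ x (y ∷ w) (here eq) z≢x | no _ = here eq
remove-⊇ x (y ∷ w) (there p) z≢x | no _ = there (remove-⊇ x w p z≢x)

remove-unique : ∀ x w → Unique w → Unique (remove x w)
remove-unique x [] [] = []
remove-unique x (y ∷ w) (h ∷ u) with y ≟ x
... | yes _ = u
... | no _ = All.tabulate (λ {z} z∈ → All.lookup h (remove-⊆ x w z∈)) ∷ remove-unique x w u

remove-all : ∀ {P : ℕ → Set} x w → All P w → All P (remove x w)
remove-all x [] [] = []
remove-all x (y ∷ w) (py ∷ al) with y ≟ x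
... | yes _ = al
... | no _ = py ∷ remove-all x w al

remove-≢ : ∀ x w → Unique w → All (_≢ x) (remove x w)
remove-≢ x [] [] = []
remove-≢ x (y ∷ w) (h ∷ u) with y ≟ x
... | yes refl = All.map (λ p eq → p (sym eq)) h
... | no y≢x = y≢x ∷ remove-≢ x w u

insertAt-length : ∀ k x v → length (insertAt k x v) ≡ suc (length v)
insertAt-length zero x v = refl
insertAt-length (suc k) x [] = refl
insertAt-length (suc k) x (y ∷ v) = cong suc (insertAt-length k x v)

insertAt-all : ∀ {P : ℕ → Set} k x v → P x → All P v → All P (insertAt k x v)
insertAt-all zero x v px al = px ∷ al
insertAt-all (suc k) x [] px [] = px ∷ []
insertAt-all (suc k) x (y ∷ v) px (py ∷ al) = py ∷ insertAt-all k x v px al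

insertAt-unique : ∀ k x v → x ∉ v → Unique v → Unique (insertAt k x v)
insertAt-unique zero x v x∉ u = All.tabulate (λ {z} z∈ eq → x∉ (subst (_∈ v) (sym eq) z∈)) ∷ u
insertAt-unique (suc k) x [] x∉ u = [] ∷ []
insertAt-unique (suc k) x (y ∷ v) x∉ (h ∷ u) =
  insertAt-all k x v (λ eq → x∉ (here (sym eq))) h ∷ insertAt-unique k x v (λ p → x∉ (there p)) u

insertAt-position : ∀ k x v → x ∉ v → k ≤ length v → position x (insertAt k x v) ≡ k
insertAt-position zero x v x∉ _ with x ≟ x
... | yes _ = refl
... | no ne = ⊥-elim (ne refl)
insertAt-position (suc k) x (y ∷ v) x∉ (s≤s le) with y ≟ x
... | yes refl = ⊥-elim (x∉ (here refl))
... | no _ = cong suc (insertAt-position k x v (λ p → x∉ (there p)) le)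

insertAt-injective : ∀ k x u v → insertAt k x u ≡ insertAt k x v → u ≡ v
insertAt-injective zero x u v refl = refl
insertAt-injective (suc k) x [] [] eq = refl
insertAt-injective (suc zero) x [] (y ∷ v) ()
insertAt-injective (suc (suc k)) x [] (y ∷ []) ()
insertAt-injective (suc (suc k)) x [] (y ∷ z ∷ v) ()
insertAt-injective (suc zero) x (y ∷ u) [] ()
insertAt-injective (suc (suc k)) x (y ∷ []) [] ()
insertAt-injective (suc (suc k)) x (y ∷ z ∷ u) [] ()
insertAt-injective (suc k) x (y ∷ u) (y' ∷ v) eq with ListP.∷-injective eq
... | refl , e = cong (y ∷_) (insertAt-injective k x u v e)

unique-⊆-length : ∀ xs ys → Unique xs → (∀ {z} → z ∈ xs → z ∈ ys) → length xs ≤ length ys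
unique-⊆-length [] ys u sub = z≤n
unique-⊆-length (x ∷ xs) ys (h ∷ u) sub =
  subst (suc (length xs) ≤_) (remove-length x ys (sub (here refl)))
    (s≤s (unique-⊆-length xs (remove x ys) u
           (λ {z} z∈ → remove-⊇ x ys (sub (there z∈)) (λ eq → All.lookup h z∈ (sym eq)))))

range-length : ∀ m → length (map suc (upTo m)) ≡ m
range-length m = trans (ListP.length-map suc (upTo m)) (ListP.length-upTo m)

max∈permutation : ∀ M w → w ∈ permutations (suc M) → suc M ∈ w
max∈permutation M w p with ∈-permutations⁻ (suc M) w p
... | len , al , u with suc M ∈? w
...   | yes M+1∈w = M+1∈w
...   | no  M+1∉w = ⊥-elim (ℕP.<-irrefl refl M+1≤M)
  where
  -- Otherwise w would be a duplicate-free word of length M+1 over 1,…,M.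
  below : ∀ {z} → z ∈ w → InRange M z
  below {z} z∈ with All.lookup al z∈
  ... | 1≤z , z≤M+1 with z ≟ suc M
  ...   | yes refl = ⊥-elim (M+1∉w z∈)
  ...   | no  z≢M+1 = 1≤z , ℕP.≤-pred (ℕP.≤∧≢⇒< z≤M+1 z≢M+1)
  M+1≤M : suc M ≤ M
  M+1≤M = subst₂ _≤_ len (range-length M) (unique-⊆-length w (map suc (upTo M)) u (λ z∈ → ∈-range⁺ (below z∈)))

insertMaxAll : ℕ → List (List ℕ)
insertMaxAll M = concatMap (λ k → map (insertAt k (suc M)) (permutations M)) (upTo (suc M))

max∉ : ∀ M v → All (InRange M) v → suc M ∉ v
max∉ M v al p with All.lookup al p
... | _ , le = ℕP.<-irrefl refl le

InRange-suc : ∀ {M z} → InRange M z → InRange (suc M) z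
InRange-suc (a , b) = a , ℕP.m≤n⇒m≤1+n b

remove-max : ∀ M {w} → w ∈ permutations (suc M) → w ∈ insertMaxAll M
remove-max M {w} p with ∈-permutations⁻ (suc M) w p
... | len , al , u =
  subst (_∈ insertMaxAll M) (insertAt-position-remove N w N∈)
    (∈-concat⁺′ (∈-map⁺ (insertAt k N) v∈) (∈-map⁺ (λ k → map (insertAt k N) (permutations M)) (∈-upTo⁺ k<)))
  where
  N = suc M
  N∈ = max∈permutation M w p
  k = position N w
  v = remove N w
  k< : k < suc M
  k< = subst (k <_) len (position< N w N∈)
  vlen : length v ≡ M
  vlen = ℕP.suc-injective (trans (remove-length N w N∈) len)
  vall : All (InRange M) v
  vall = All.zipWith (λ { ((a , b) , ne) → a , ℕP.≤-pred (ℕP.≤∧≢⇒< b ne) }) (remove-all N w al , remove-≢ N w u)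
  v∈ : v ∈ permutations M
  v∈ = ∈-permutations⁺ M v vlen vall (remove-unique N w u)

insert-max : ∀ M {w} → w ∈ insertMaxAll M → w ∈ permutations (suc M)
insert-max M {w} p with ∈-concat⁻′ (map (λ k → map (insertAt k (suc M)) (permutations M)) (upTo (suc M))) p
... | vs , w∈vs , vs∈ with ∈-map⁻ (λ k → map (insertAt k (suc M)) (permutations M)) {xs = upTo (suc M)} vs∈
... | k , k∈ , refl with ∈-map⁻ (insertAt k (suc M)) w∈vs
... | v , v∈ , refl with ∈-permutations⁻ M v v∈
... | len , al , u = ∈-permutations⁺ (suc M) (insertAt k (suc M) v) (trans (insertAt-length k (suc M) v) (cong suc len))
        (insertAt-all k (suc M) v (s≤s z≤n , ℕP.≤-refl) (All.map InRange-suc al))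
        (insertAt-unique k (suc M) v (max∉ M v al) u)

insertMaxAll-unique : ∀ M → Unique (insertMaxAll M)
insertMaxAll-unique M =
  UniqueP.concat⁺
    (AllP.map⁺ (All.universal (λ k → UniqueP.map⁺ (λ {u} {v} → insertAt-injective k (suc M) u v)
                                                  (permutations-unique M))
                              (upTo (suc M))))
    (AllPairsP.map⁺ (AllPairsP.applyUpTo⁺₁ (λ i → i) (suc M) disj))
  where
  -- Insertions at different positions are told apart by the position of M+1.
  disj : ∀ {i j} → i < j → j < suc M →
         Disjoint (map (insertAt i (suc M)) (permutations M)) (map (insertAt j (suc M)) (permutations M))
  disj {i} {j} i<j j<N (p , q) with ∈-map⁻ (insertAt i (suc M)) p | ∈-map⁻ (insertAt j (suc M)) q
  ... | v , v∈ , refl | v' , v'∈ , eq with ∈-permutations⁻ M v v∈ | ∈-permutations⁻ M v' v'∈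
  ... | len , al , _ | len' , al' , _ =
    ℕP.<-irrefl (begin
      i                                         ≡⟨ sym (insertAt-position i (suc M) v (max∉ M v al) i≤|v|) ⟩
      position (suc M) (insertAt i (suc M) v)   ≡⟨ cong (position (suc M)) eq ⟩
      position (suc M) (insertAt j (suc M) v')  ≡⟨ insertAt-position j (suc M) v' (max∉ M v' al') j≤|v'| ⟩
      j                                         ∎) i<j
    where
    i≤|v| = subst (i ≤_) (sym len) (ℕP.≤-pred (ℕP.<-trans i<j j<N))
    j≤|v'| = subst (j ≤_) (sym len') (ℕP.≤-pred j<N)

permutations-by-max : ∀ M → permutations (suc M) ↭ insertMaxAll M
permutations-by-max M = ∼bag⇒↭ (unique∧set⇒bag (permutations-unique (suc M)) (insertMaxAll-unique M) 
  (mk⇔ (remove-max M) (insert-max M)))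

Σ-permutations-by-max : ∀ M (F : List ℕ → ℕ) →
  Σℕ.Σ F (permutations (suc M)) ≡ Σℕ.Σ< (suc M) (λ k → Σℕ.Σ (λ v → F (insertAt k (suc M) v)) (permutations M))
Σ-permutations-by-max M F = begin
  Σℕ.Σ F (permutations (suc M))
    ≡⟨ sum-↭ (PermP.map⁺ F (permutations-by-max M)) ⟩
  Σℕ.Σ F (insertMaxAll M)
    ≡⟨ Σℕ.Σ-concatMap F (λ k → map (insertAt k (suc M)) (permutations M)) (upTo (suc M)) ⟩
  Σℕ.Σ (λ k → Σℕ.Σ F (map (insertAt k (suc M)) (permutations M))) (upTo (suc M))
    ≡⟨ Σℕ.Σ-applyUpTo _ (λ i → i) (suc M) ⟩
  Σℕ.Σ< (suc M) (λ k → Σℕ.Σ F (map (insertAt k (suc M)) (permutations M)))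
    ≡⟨ Σℕ.Σ<-cong (suc M) (λ k → Σℕ.Σ-map F (insertAt k (suc M)) (permutations M)) ⟩
  Σℕ.Σ< (suc M) (λ k → Σℕ.Σ (λ v → F (insertAt k (suc M) v)) (permutations M))
    ∎

descentWord : List ℕ → List Bool
descentWord []           = []
descentWord (x ∷ [])     = []
descentWord (x ∷ y ∷ ws) = does (y <? x) ∷ descentWord (y ∷ ws)

descentWord-length : ∀ x w → suc (length (descentWord (x ∷ w))) ≡ length (x ∷ w)
descentWord-length x []      = refl
descentWord-length x (y ∷ w) = cong suc (descentWord-length y w)

descentWord-insertAt : ∀ k N y v → All (_< N) (y ∷ v) →
                       descentWord (insertAt k N (y ∷ v)) ≡ insMax k (descentWord (y ∷ v))
descentWord-insertAt zero N y v (y<N ∷ _) = cong (_∷ descentWord (y ∷ v)) (dec-true (y <? N) y<N)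
descentWord-insertAt (suc zero) N y [] (y<N ∷ _) = cong (_∷ []) (dec-false (N <? y) (ℕP.<⇒≯ y<N))
descentWord-insertAt (suc (suc k)) N y [] (y<N ∷ _) = cong (_∷ []) (dec-false (N <? y) (ℕP.<⇒≯ y<N))
descentWord-insertAt (suc zero) N y (z ∷ v) (y<N ∷ z<N ∷ _) =
  cong₂ _∷_ (dec-false (N <? y) (ℕP.<⇒≯ y<N)) (cong (_∷ descentWord (z ∷ v)) (dec-true (z <? N) z<N))
descentWord-insertAt (suc (suc k)) N y (z ∷ v) (_ ∷ v<N) =
  cong (does (z <? y) ∷_) (descentWord-insertAt (suc k) N z v v<N)

positionsFrom : ℕ → List Bool → List ℕ
positionsFrom k []      = []
positionsFrom k (b ∷ t) = if b then k ∷ positionsFrom (suc k) t else positionsFrom (suc k) t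

descentsFrom-positions : ∀ k w → descentsFrom k w ≡ positionsFrom k (descentWord w)
descentsFrom-positions k []           = refl
descentsFrom-positions k (x ∷ [])     = refl
descentsFrom-positions k (x ∷ y ∷ ws) =
  cong (λ z → if does (y <? x) then k ∷ z else z) (descentsFrom-positions (suc k) (y ∷ ws))

positionsFrom-≥ : ∀ k t → All (k ≤_) (positionsFrom k t)
positionsFrom-≥ k []          = []
positionsFrom-≥ k (true ∷ t)  = ℕP.≤-refl ∷ All.map (ℕP.≤-trans (ℕP.n≤1+n k)) (positionsFrom-≥ (suc k) t)
positionsFrom-≥ k (false ∷ t) = All.map (ℕP.≤-trans (ℕP.n≤1+n k)) (positionsFrom-≥ (suc k) t)

positionsFrom-injective : ∀ k r r′ → positionsFrom k r ≡ positionsFrom k r′ → length r ≡ length r′ → r ≡ r′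
positionsFrom-injective k []          []           eq len = refl
positionsFrom-injective k (true ∷ r)  (true ∷ r′)  eq len =
  cong (true ∷_) (positionsFrom-injective (suc k) r r′ (ListP.∷-injectiveʳ eq) (ℕP.suc-injective len))
positionsFrom-injective k (false ∷ r) (false ∷ r′) eq len =
  cong (false ∷_) (positionsFrom-injective (suc k) r r′ eq (ℕP.suc-injective len))
positionsFrom-injective k (true ∷ r)  (false ∷ r′) eq len = ⊥-elim (k∉ (sym eq) (positionsFrom-≥ (suc k) r′))
  where
  k∉ : ∀ {l} → l ≡ k ∷ positionsFrom (suc k) r → ¬ All (suc k ≤_) l
  k∉ refl (k<k ∷ _) = ℕP.<-irrefl refl k<k
positionsFrom-injective k (false ∷ r) (true ∷ r′)  eq len = ⊥-elim (k∉ eq (positionsFrom-≥ (suc k) r))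
  where
  k∉ : ∀ {l} → l ≡ k ∷ positionsFrom (suc k) r′ → ¬ All (suc k ≤_) l
  k∉ refl (k<k ∷ _) = ℕP.<-irrefl refl k<k

descentCount : List Bool → ℕ
descentCount r = Σℕ.Σ (λ w → ind (sameWord (descentWord w) r)) (permutations (suc (length r)))

-- Inserting the maximum in front creates a descent; elsewhere it creates a
-- change of bits (pullback-inner).
descentCount-rec : ∀ d r →
  descentCount (d ∷ r) ≡ pullback 0 (d ∷ r) descentCount + changeSum true (d ∷ r) descentCount
descentCount-rec d r = begin
  Σℕ.Σ F (permutations (suc M))
    ≡⟨ Σ-permutations-by-max M F ⟩
  Σℕ.Σ< (suc M) (λ k → Σℕ.Σ (λ v → F (insertAt k (suc M) v)) (permutations M))
    ≡⟨ Σℕ.Σ<-cong (suc M) at-position ⟩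
  Σℕ.Σ< (suc M) (λ k → pullback k r₀ descentCount)
    ≡⟨ cong (_+_ (pullback 0 r₀ descentCount)) (pullback-inner r₀ descentCount) ⟩
  pullback 0 r₀ descentCount + changeSum true r₀ descentCount
    ∎
  where
  r₀ = d ∷ r
  M  = suc (length r)
  F  = λ w → ind (sameWord (descentWord w) r₀)
  from-v : ∀ k v → v ∈ permutations M → F (insertAt k (suc M) v) ≡ pullback k r₀ (λ t → ind (sameWord (descentWord v) t))
  from-v k v v∈ with ∈-permutations⁻ M v v∈
  from-v k (y ∷ v) v∈ | _ , v-range , _ =
    trans (cong (λ z → ind (sameWord z r₀)) (descentWord-insertAt k (suc M) y v (All.map (λ p → s≤s (proj₂ p)) v-range)))
          (pullback-indicator k (descentWord (y ∷ v)) r₀)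
  at-position : ∀ k → Σℕ.Σ (λ v → F (insertAt k (suc M) v)) (permutations M) ≡ pullback k r₀ descentCount
  at-position k = begin
    Σℕ.Σ (λ v → F (insertAt k (suc M) v)) (permutations M)
      ≡⟨ Σℕ.Σ-cong∈ (permutations M) (λ {v} → from-v k v) ⟩
    Σℕ.Σ (λ v → pullback k r₀ (λ t → ind (sameWord (descentWord v) t))) (permutations M)
      ≡⟨ pullback-sum k r₀ (λ v t → ind (sameWord (descentWord v) t)) (permutations M) ⟩
    pullback k r₀ (λ t → Σℕ.Σ (λ v → ind (sameWord (descentWord v) t)) (permutations M))
      ≡⟨ pullback-cong k r₀ (λ t |t|+1≡M → cong (λ n → Σℕ.Σ (λ v → ind (sameWord (descentWord v) t)) (permutations n))
                                                  (sym |t|+1≡M)) ⟩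
    pullback k r₀ descentCount
      ∎

does-reflects : ∀ {A : Set} (d : Dec A) (b : Bool) → (b ≡ true → A) → (A → b ≡ true) → does d ≡ b
does-reflects (yes a) true  _ _ = refl
does-reflects (yes a) false _ h with () ← h a
does-reflects (no ¬a) true  h _ = ⊥-elim (¬a (h refl))
does-reflects (no ¬a) false _ _ = refl

length≡Σ1 : ∀ {A : Set} (L : List A) → length L ≡ Σℕ.Σ (λ _ → 1) L
length≡Σ1 []      = refl
length≡Σ1 (x ∷ L) = cong suc (length≡Σ1 L)

β-descentCount : ∀ r → β (suc (length r)) (positionsFrom 1 r) ≡ descentCount r
β-descentCount r = begin
  length (filter has-S perms)                          ≡⟨ length≡Σ1 (filter has-S perms) ⟩
  Σℕ.Σ (λ _ → 1) (filter has-S perms)                  ≡⟨ Σℕ.Σ-filter has-S (λ _ → 1) perms ⟩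
  Σℕ.Σ (λ w → ind (does (has-S w))) perms              ≡⟨ Σℕ.Σ-cong∈ perms (λ {w} w∈ → cong ind (same w w∈)) ⟩
  Σℕ.Σ (λ w → ind (sameWord (descentWord w) r)) perms  ∎
  where
  perms = permutations (suc (length r))
  has-S = λ w → ListP.≡-dec _≟_ (descentSet w) (positionsFrom 1 r)
  same : ∀ w → w ∈ perms → does (has-S w) ≡ sameWord (descentWord w) r
  same w w∈ with ∈-permutations⁻ (suc (length r)) w w∈
  same (x ∷ w) w∈ | |w|≡ , _ = does-reflects (has-S (x ∷ w)) (sameWord (descentWord (x ∷ w)) r)
    (λ e → trans (descentsFrom-positions 1 (x ∷ w)) (cong (positionsFrom 1) (sameWord-sound (descentWord (x ∷ w)) r e)))
    (λ e → subst (λ z → sameWord z r ≡ true)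
                 (sym (positionsFrom-injective 1 (descentWord (x ∷ w)) r
                        (trans (sym (descentsFrom-positions 1 (x ∷ w))) e)
                        (ℕP.suc-injective (trans (descentWord-length x w) |w|≡))))
                 (sameWord-refl r))

oddShiftedFrom-positions : ∀ k xs → oddShiftedFrom k xs ≡ positionsFrom k (map isOdd xs)
oddShiftedFrom-positions k []       = refl
oddShiftedFrom-positions k (x ∷ xs) with x % 2 ≟ 1 | isOdd x | isOdd-% x
... | yes _    | true  | _ = cong (k ∷_) (oddShiftedFrom-positions (suc k) xs)
... | yes x%2≡1 | false | e with () ← trans (sym x%2≡1) e
... | no x%2≢1 | true  | e = ⊥-elim (x%2≢1 e)
... | no _     | false | _ = oddShiftedFrom-positions (suc k) xs

maxList-bound : ∀ xs → All (_≤ maxList xs) xs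
maxList-bound []       = []
maxList-bound (x ∷ xs) = ℕP.m≤m⊔n x _ ∷ All.map (λ p → ℕP.≤-trans p (ℕP.m≤n⊔m x _)) (maxList-bound xs)

open ParityEvaluation descentCount refl descentCount-rec using (P; J-parities)

theorem2p4 : (a₁ : ℕ) (as : List ℕ) →
    Sorted ≤-totalOrder (a₁ ∷ as) → All (1 ≤_) (a₁ ∷ as) →
    ((a₁ % 2 ≡ 0) → I (a₁ ∷ as) (- + 1) ≡ + 0)
    × ((a₁ % 2 ≡ 1) →
       I (a₁ ∷ as) (- + 1)
         ≡ ((- + 1) ^ (sum (a₁ ∷ as) ∸ length (a₁ ∷ as)))
           * + β (length (a₁ ∷ as)) (oddShiftedFrom 1 as))
theorem2p4 a₁ as sorted positive = even-case , odd-case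
  where
  a = a₁ ∷ as
  I≡P : I a (- + 1) ≡ P (isOdd a₁ ∷ map isOdd as)
  I≡P = trans (I-as-J a) (J-parities (length a) (maxList a) a refl sorted (maxList-bound a))
  even-case : a₁ % 2 ≡ 0 → I a (- + 1) ≡ + 0
  even-case a₁-even = trans I≡P (cong (λ b → P (b ∷ map isOdd as)) (%2≡0⇒even a₁ a₁-even))
  odd-case : a₁ % 2 ≡ 1 → I a (- + 1) ≡ (- + 1) ^ (sum a ∸ length a) * + β (length a) (oddShiftedFrom 1 as)
  odd-case a₁-odd = begin
    I a (- + 1)                                        ≡⟨ I≡P ⟩
    P (isOdd a₁ ∷ map isOdd as)                        ≡⟨ cong (λ b → P (b ∷ map isOdd as)) a₁-true ⟩
    σ (map isOdd as) * + descentCount (map isOdd as)   ≡⟨ cong₂ _*_ sign-eq (cong +_ (sym β-eq)) ⟩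
    (- + 1) ^ (sum a ∸ length a) * + β (length a) (oddShiftedFrom 1 as) ∎
    where
    a₁-true = %2≡1⇒odd a₁ a₁-odd
    sign-eq : σ (map isOdd as) ≡ (- + 1) ^ (sum a ∸ length a)
    sign-eq = sym (begin
      (- + 1) ^ (sum a ∸ length a)    ≡⟨ sign-pow (sum a ∸ length a) ⟩
      sign (sum a ∸ length a)         ≡⟨ sign-sum a positive ⟩
      σ (isOdd a₁ ∷ map isOdd as)     ≡⟨ cong (λ b → σ (b ∷ map isOdd as)) a₁-true ⟩
      σ (map isOdd as)                ∎)
    β-eq : β (length a) (oddShiftedFrom 1 as) ≡ descentCount (map isOdd as)
    β-eq = trans (cong₂ β (cong suc (sym (ListP.length-map isOdd as))) (oddShiftedFrom-positions 1 as))
                 (β-descentCount (map isOdd as))
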